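{- If $G$ is a graph with $n(G)\ge 2$ vertices that has a universal vertex, then $\mu(D(G))=2n(G)-1$.
   Context: All graphs are finite and simple; $n(G)$ is the order of $G$. A universal vertex is one adjacent to all other vertices. The double graph $D(G)$ is obtained from the disjoint union of $G$ and a copy $G'$ with $V(G')=\{u': u\in V(G)\}$ by joining each $u\in V(G)$ to all neighbors of $u'$ in $G'$ and each $u'$ to all neighbors of $u$ in $G$; thus $N_{D(G)}(u)=N_{D(G)}(u')$ for all $u\in V(G)$. Given $S\subseteq V(H)$, two vertices $x,y$ of $H$ are $S$-visible if some shortest $x,y$-path in $H$ has no internal vertex in $S$; $S$ is a mutual-visibility set if every two vertices of $S$ are $S$-visible, and $\mu(H)$ is the maximum size of a mutual-visibility set of $H$. -}

module Defs where

open import Level using (0ℓ)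
open import Data.Nat using (ℕ; zero; suc; _≤_)
open import Data.Fin using (Fin)
open import Data.Sum using (_⊎_; inj₁; inj₂)
open import Data.Product using (Σ; _×_; _,_)
open import Data.Unit using (⊤)
open import Data.List using (List; length)
open import Data.List.Membership.Propositional using (_∈_)
open import Data.List.Relation.Unary.Unique.Propositional using (Unique)
open import Relation.Binary.PropositionalEquality using (_≡_)
open import Relation.Nullary using (¬_)
open import Relation.Binary.Core using (Rel)
open import Relation.Binary.Definitions using (Decidable; Symmetric; Irreflexive)

record Graph (V : Set) : Set₁ where
  field
    Adj    : Rel V 0ℓ
    adj?   : Decidable Adj
    sym    : Symmetric Adj
    irrefl : Irreflexive _≡_ Adj
open Graph public

module _ {V : Set} (H : Graph V) where

  data Walk : V → V → Set where
    []  : ∀ {x} → Walk x x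
    _∷_ : ∀ {x y z} → Adj H x y → Walk y z → Walk x z

  len : ∀ {x y} → Walk x y → ℕ
  len []      = zero
  len (_ ∷ w) = suc (len w)

  IsShortest : ∀ {x y} → Walk x y → Set
  IsShortest {x} {y} w = (w' : Walk x y) → len w ≤ len w'

  NoInternalIn : List V → ∀ {x y} → Walk x y → Set
  NoInternalIn S []                         = ⊤
  NoInternalIn S (_ ∷ [])                   = ⊤
  NoInternalIn S (_∷_ {y = m} _ w@(_ ∷ _))  = ¬ (m ∈ S) × NoInternalIn S w

  Visible : List V → V → V → Set
  Visible S x y = Σ (Walk x y) λ w → IsShortest w × NoInternalIn S w

  IsMutualVisibilitySet : List V → Set
  IsMutualVisibilitySet S = Unique S × (∀ x y → x ∈ S → y ∈ S → Visible S x y)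

  MuEquals : ℕ → Set
  MuEquals k =
    (Σ (List V) λ S → IsMutualVisibilitySet S × length S ≡ k)
    × (∀ S → IsMutualVisibilitySet S → length S ≤ k)

-- the vertex of G underlying a vertex of D(G): inj₁ u ↦ u, inj₂ u (= u') ↦ u
base : ∀ {n} → Fin n ⊎ Fin n → Fin n
base (inj₁ u) = u
base (inj₂ u) = u

-- double graph D(G) on V(G) ⊎ V(G'): a ~ b iff base a ~ base b in G
-- (u~v, u'~v', u~v', u'~v exactly when uv ∈ E(G))
D : ∀ {n} → Graph (Fin n) → Graph (Fin n ⊎ Fin n)
D G = record
  { Adj    = λ a b → Adj G (base a) (base b)
  ; adj?   = λ a b → adj? G (base a) (base b)
  ; sym    = sym G
  ; irrefl = λ { {inj₁ _} {inj₁ _} _≡_.refl e → irrefl G _≡_.refl e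
               ; {inj₂ _} {inj₂ _} _≡_.refl e → irrefl G _≡_.refl e } }

IsUniversal : ∀ {n} → Graph (Fin n) → Fin n → Set
IsUniversal G u = ∀ v → ¬ (v ≡ u) → Adj G u v

{-# OPTIONS --safe #-}
module Submission where

open import Defs
open import Data.Nat using (ℕ; zero; suc; pred; _+_; _*_; _∸_; _≤_; _<_; z≤n; s≤s)
open import Data.Nat.Properties using (+-identityʳ; <⇒≤pred)
open import Data.Fin using (Fin; zero; suc; punchIn) renaming (_≟_ to _≟ᶠ_)
open import Data.Fin.Properties using (injective⇒≤; punchInᵢ≢i; punchIn-injective; +↔⊎)
open import Data.Sum using (_⊎_; inj₁; inj₂)
open import Data.Sum.Properties using (≡-dec; inj₁-injective; inj₂-injective)
open import Data.Product using (Σ; ∃-syntax; _×_; _,_)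
open import Data.Unit using (tt)
open import Data.List using (List; []; _∷_; length; lookup; map; _++_; allFin)
open import Data.List.Properties using (length-++; length-map; length-tabulate)
open import Data.List.Membership.Propositional using (_∈_; _∉_)
open import Data.List.Membership.Propositional.Properties using (∈-lookup; ∈-map⁻; ∈-++⁻)
open import Data.List.Relation.Unary.Any using (any?)
import Data.List.Relation.Unary.All as All
open import Data.List.Relation.Unary.All.Properties using (¬Any⇒All¬)
open import Data.List.Relation.Unary.AllPairs using (_∷_)
open import Data.List.Relation.Unary.Unique.Propositional using (Unique)
import Data.List.Relation.Unary.Unique.Propositional.Properties as Unique
open import Function using (_∘_; id)
open import Function.Bundles using (Injection; _↣_)
open import Function.Definitions using (Injective)
open import Function.Properties.Inverse using (↔⇒↣; ↔-sym)
open import Relation.Binary.Definitions using (DecidableEquality)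
import Relation.Binary.PropositionalEquality as ≡
open import Relation.Binary.PropositionalEquality
  using (_≡_; _≢_; refl; cong; cong₂; subst; ≢-sym; module ≡-Reasoning)
open import Relation.Nullary using (¬_; yes; no; contradiction)

-- In D(G) every u is a twin of u': distinct, non-adjacent, at distance 2 (or
-- unreachable).  A mutual-visibility set containing both twins must omit an
-- internal vertex of a shortest u,u'-path, so no such set is all of V(D(G)),
-- giving μ(D(G)) ≤ 2n - 1 for every G.  Conversely, if w is universal in G,
-- any two vertices of D(G) other than w are equal, adjacent or both adjacent
-- to w, so V(D(G)) ∖ {w} is a mutual-visibility set.

pred[n+n]≡2*n∸1 : ∀ n → pred (n + n) ≡ 2 * n ∸ 1
pred[n+n]≡2*n∸1 zero    = refl
pred[n+n]≡2*n∸1 (suc n) = cong (λ k → n + suc k) (≡.sym (+-identityʳ n))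

module _ {A : Set} where

  lookup-injective : ∀ {xs : List A} → Unique xs → Injective _≡_ _≡_ (lookup xs)
  lookup-injective (_   ∷ _) {zero}  {zero}  _  = refl
  lookup-injective (x≢ ∷ _) {zero}  {suc j} eq = contradiction eq (All.lookup x≢ (∈-lookup j))
  lookup-injective (x≢ ∷ _) {suc i} {zero}  eq = contradiction eq (≢-sym (All.lookup x≢ (∈-lookup i)))
  lookup-injective (_   ∷ u) {suc i} {suc j} eq = cong suc (lookup-injective u eq)

  unique-∉⇒length< : ∀ {m z} {xs : List A} → A ↣ Fin m → Unique xs → z ∉ xs → length xs < m
  unique-∉⇒length< {z = z} {xs} ι u z∉xs =
    injective⇒≤ {f = Injection.to ι ∘ lookup (z ∷ xs)}
      (lookup-injective (¬Any⇒All¬ xs z∉xs ∷ u) ∘ Injection.injective ι)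

module _ {V : Set} (H : Graph V) where

  len-≥1 : ∀ {x y} → x ≢ y → (p : Walk H x y) → 1 ≤ len H p
  len-≥1 x≢y []      = contradiction refl x≢y
  len-≥1 _   (_ ∷ _) = s≤s z≤n

  len-≥2 : ∀ {x y} → x ≢ y → ¬ Adj H x y → (p : Walk H x y) → 2 ≤ len H p
  len-≥2 x≢y _   []          = contradiction refl x≢y
  len-≥2 _   x≁y (e ∷ [])    = contradiction e x≁y
  len-≥2 _   _   (_ ∷ _ ∷ _) = s≤s (s≤s z≤n)

  visible-via : DecidableEquality V → ∀ {S c x y} → c ∉ S →
                (x ≢ y → ¬ Adj H x y → Adj H x c × Adj H c y) → Visible H S x y
  visible-via _≟_ {x = x} {y} c∉S common with x ≟ y | adj? H x y
  ... | yes refl | _     = [] , (λ _ → z≤n) , tt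
  ... | no x≢y   | yes e = e ∷ [] , len-≥1 x≢y , tt
  ... | no x≢y   | no x≁y with common x≢y x≁y
  ...   | xc , cy = xc ∷ cy ∷ [] , len-≥2 x≢y x≁y , c∉S , tt

  nonadjacent-visible⇒∃∉ : ∀ {S x y} → x ≢ y → ¬ Adj H x y → Visible H S x y → ∃[ z ] z ∉ S
  nonadjacent-visible⇒∃∉ x≢y _   ([] , _)                               = contradiction refl x≢y
  nonadjacent-visible⇒∃∉ _   x≁y ((e ∷ []) , _)                         = contradiction e x≁y
  nonadjacent-visible⇒∃∉ _   _   ((_∷_ {y = z} _ (_ ∷ _)) , _ , z∉S , _) = z , z∉S

  mutualVisibility⇒∃∉ : DecidableEquality V → ∀ {S x y} → IsMutualVisibilitySet H S →
                        x ≢ y → ¬ Adj H x y → ∃[ z ] z ∉ S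
  mutualVisibility⇒∃∉ _≟_ {S} {x} {y} (_ , visible) x≢y x≁y
    with any? (x ≟_) S | any? (y ≟_) S
  ... | no x∉S  | _       = x , x∉S
  ... | yes _   | no y∉S  = y , y∉S
  ... | yes x∈S | yes y∈S = nonadjacent-visible⇒∃∉ x≢y x≁y (visible x y x∈S y∈S)

_≟ᴰ_ : ∀ {n} → DecidableEquality (Fin n ⊎ Fin n)
_≟ᴰ_ = ≡-dec _≟ᶠ_ _≟ᶠ_

D-mutualVisibility-length≤ : ∀ {n} (G : Graph (Fin n)) {S} →
                             IsMutualVisibilitySet (D G) S → length S ≤ 2 * n ∸ 1
D-mutualVisibility-length≤ G {[]}    _ = z≤n
D-mutualVisibility-length≤ {n} G {v ∷ S} mvs@(unique , _) with
  mutualVisibility⇒∃∉ (D G) _≟ᴰ_ {x = inj₁ (base v)} {y = inj₂ (base v)} mvs (λ ()) (irrefl G refl)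
... | _ , z∉S = subst (length (v ∷ S) ≤_) (pred[n+n]≡2*n∸1 n)
                  (<⇒≤pred (unique-∉⇒length< (↔⇒↣ (↔-sym +↔⊎)) unique z∉S))

module _ {n} (G : Graph (Fin n)) {w} (w-universal : IsUniversal G w) where

  nonadjacent⇒base≢universal : ∀ {x y} → x ≢ inj₁ w → y ≢ inj₁ w → x ≢ y →
                               ¬ Adj (D G) x y → base x ≢ w
  nonadjacent⇒base≢universal {inj₁ _}          x≢w _   _   _   refl = x≢w refl
  nonadjacent⇒base≢universal {inj₂ _} {inj₁ _} _   y≢w _   x≁y refl =
    x≁y (w-universal _ (y≢w ∘ cong inj₁))
  nonadjacent⇒base≢universal {inj₂ _} {inj₂ _} _   _   x≢y x≁y refl =
    x≁y (w-universal _ (≢-sym x≢y ∘ cong inj₂))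

  universal∉⇒mutualVisibility : ∀ {S} → Unique S → inj₁ w ∉ S → IsMutualVisibilitySet (D G) S
  universal∉⇒mutualVisibility {S} unique w∉S =
    unique , λ x y x∈S y∈S → visible-via (D G) _≟ᴰ_ w∉S (common (≢w x∈S) (≢w y∈S))
    where
      ≢w : ∀ {x} → x ∈ S → x ≢ inj₁ w
      ≢w x∈S refl = w∉S x∈S

      common : ∀ {x y} → x ≢ inj₁ w → y ≢ inj₁ w → x ≢ y → ¬ Adj (D G) x y →
               Adj (D G) x (inj₁ w) × Adj (D G) (inj₁ w) y
      common {x} {y} x≢w y≢w x≢y x≁y =
        Graph.sym G (w-universal (base x) (nonadjacent⇒base≢universal x≢w y≢w x≢y x≁y)) ,
        w-universal (base y)
          (nonadjacent⇒base≢universal y≢w x≢w (≢-sym x≢y) (x≁y ∘ Graph.sym G))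

module _ {m} (w : Fin (suc m)) where

  allExcept-inj₁ : List (Fin (suc m) ⊎ Fin (suc m))
  allExcept-inj₁ = map (inj₁ ∘ punchIn w) (allFin m) ++ map inj₂ (allFin (suc m))

  inj₁∉allExcept-inj₁ : inj₁ w ∉ allExcept-inj₁
  inj₁∉allExcept-inj₁ w∈ with ∈-++⁻ (map (inj₁ ∘ punchIn w) (allFin m)) w∈
  ... | inj₁ w∈ˡ with ∈-map⁻ (inj₁ ∘ punchIn w) w∈ˡ
  ...   | i , _ , eq = punchInᵢ≢i w i (≡.sym (inj₁-injective eq))
  inj₁∉allExcept-inj₁ w∈ | inj₂ w∈ʳ with ∈-map⁻ inj₂ w∈ʳ
  ...   | _ , _ , ()

  allExcept-inj₁-unique : Unique allExcept-inj₁
  allExcept-inj₁-unique = Unique.++⁺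
    (Unique.map⁺ (punchIn-injective w _ _ ∘ inj₁-injective) (Unique.allFin⁺ m))
    (Unique.map⁺ inj₂-injective (Unique.allFin⁺ (suc m)))
    disjoint
    where
      disjoint : ∀ {v} → ¬ (v ∈ map (inj₁ ∘ punchIn w) (allFin m)
                            × v ∈ map inj₂ (allFin (suc m)))
      disjoint (v∈ˡ , v∈ʳ) with ∈-map⁻ (inj₁ ∘ punchIn w) v∈ˡ | ∈-map⁻ inj₂ v∈ʳ
      ... | _ , _ , refl | _ , _ , ()

  length-allExcept-inj₁ : length allExcept-inj₁ ≡ 2 * suc m ∸ 1
  length-allExcept-inj₁ = begin
    length (map (inj₁ ∘ punchIn w) (allFin m) ++ map inj₂ (allFin (suc m)))
      ≡⟨ length-++ (map (inj₁ ∘ punchIn w) (allFin m)) ⟩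
    length (map (inj₁ ∘ punchIn w) (allFin m)) + length (map inj₂ (allFin (suc m)))
      ≡⟨ cong₂ _+_ (length-map (inj₁ ∘ punchIn w) (allFin m))
                   (length-map inj₂ (allFin (suc m))) ⟩
    length (allFin m) + length (allFin (suc m))
      ≡⟨ cong₂ _+_ (length-tabulate {n = m} id) (length-tabulate {n = suc m} id) ⟩
    pred (suc m + suc m)
      ≡⟨ pred[n+n]≡2*n∸1 (suc m) ⟩
    2 * suc m ∸ 1 ∎
    where open ≡-Reasoning

mainTheorem2 : (n : ℕ) → 2 ≤ n → (G : Graph (Fin n)) →
    Σ (Fin n) (IsUniversal G) →
    MuEquals (D G) (2 * n ∸ 1)
mainTheorem2 (suc m) _ G (w , w-universal) =
  ( allExcept-inj₁ w
  , universal∉⇒mutualVisibility G w-universal (allExcept-inj₁-unique w) (inj₁∉allExcept-inj₁ w)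
  , length-allExcept-inj₁ w )
  , λ _ → D-mutualVisibility-length≤ G
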